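{- Let $k\geq 1$ and $n\geq 1$ be integers. Among all skew Dyck paths having exactly $n$ factors equal to $UD^{k}L$, the minimum possible semilength is $(k+2)n-1$.
   Context: A skew Dyck path is a word $w$ over the alphabet $\{U,D,L\}$ such that: $w$ contains neither $UL$ nor $LU$ as a contiguous subword; the number of $U$s in $w$ equals the total number of $D$s and $L$s; and in every prefix of $w$ the total number of $D$s and $L$s is at most the number of $U$s. (Geometrically $U=(1,1)$, $D=(1,-1)$, $L=(-1,-1)$, and the path starts at the origin, ends on the $x$-axis and never goes below it.) The semilength is the number of $U$s. A factor is a contiguous subword; $X^{m}$ denotes $m$ consecutive copies of the letter $X$. -}

module Defs where

open import Data.Nat using (ℕ; zero; suc; _+_; _≤_)
open import Data.List using (List; []; _∷_; _++_; replicate; length; filter)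
open import Data.Bool using (Bool; true; false; if_then_else_)
open import Data.Product using (_×_; Σ; ∃)
open import Relation.Binary.PropositionalEquality using (_≡_; refl)
open import Relation.Nullary using (¬_; Dec; yes; no)

-- Steps of a skew Dyck path: U = (1,1), D = (1,-1), L = (-1,-1).
data Step : Set where
  U D L : Step

Word : Set
Word = List Step

#U : Word → ℕ
#U []       = 0
#U (U ∷ w)  = suc (#U w)
#U (D ∷ w)  = #U w
#U (L ∷ w)  = #U w

#DL : Word → ℕ
#DL []      = 0
#DL (U ∷ w) = #DL w
#DL (D ∷ w) = suc (#DL w)
#DL (L ∷ w) = suc (#DL w)

_IsFactorOf_ : Word → Word → Set
v IsFactorOf w = Σ Word λ p → Σ Word λ s → w ≡ p ++ (v ++ s)

record IsSkewDyck (w : Word) : Set where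
  field
    noUL     : ¬ ((U ∷ L ∷ []) IsFactorOf w)
    noLU     : ¬ ((L ∷ U ∷ []) IsFactorOf w)
    balanced : #U w ≡ #DL w
    prefixes : ∀ (p s : Word) → w ≡ p ++ s → #DL p ≤ #U p

semilength : Word → ℕ
semilength = #U

_≟S_ : (a b : Step) → Dec (a ≡ b)
U ≟S U = yes refl
U ≟S D = no λ ()
U ≟S L = no λ ()
D ≟S U = no λ ()
D ≟S D = yes refl
D ≟S L = no λ ()
L ≟S U = no λ ()
L ≟S D = no λ ()
L ≟S L = yes refl

isPrefix : Word → Word → Bool
isPrefix []      _        = true
isPrefix (_ ∷ _) []       = false
isPrefix (a ∷ v) (b ∷ w) with a ≟S b
... | yes _ = isPrefix v w
... | no  _ = false

-- number of occurrences of v as a factor of w (number of starting positions,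
-- overlapping occurrences counted separately)
occurrences : Word → Word → ℕ
occurrences v []        = if isPrefix v [] then 1 else 0
occurrences v (a ∷ w)   = (if isPrefix v (a ∷ w) then 1 else 0) + occurrences v w

UDkL : ℕ → Word
UDkL k = U ∷ (replicate k D ++ (L ∷ []))

-- Each occurrence of U D^k L contributes k + 1 down-steps, and, unless it ends the path, is
-- followed by another down-step, since L can never be followed by U. Occurrences cannot
-- overlap, so n occurrences force (k + 2) n - 1 down-steps, hence as many up-steps. The bound
-- is attained by U^((k+1) n - 1) U D^k L (D U D^k L)^(n-1).
module Submission where

open import Defs
open import Data.Nat using (ℕ; zero; suc; _+_; _*_; _∸_; _≤_; _<_; _≥_; z≤n; s≤s)
open import Data.Nat.Properties
  using (≤-refl; ≤-trans; n≤1+n; m≤n+m; +-monoʳ-≤; ∸-monoˡ-≤; +-suc; +-identityʳ; +-comm; *-comm; module ≤-Reasoning)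
open import Data.Nat.Induction using (<-wellFounded)
open import Data.Nat.Tactic.RingSolver using (solve-∀)
open import Data.List using ([]; _∷_; _++_; replicate; length)
open import Data.List.Properties using (++-assoc)
open import Data.List.Relation.Unary.Linked as Linked using (Linked; [-]; _∷_)
open import Data.Bool using (true; false)
open import Data.Empty using (⊥; ⊥-elim)
open import Data.Sum using (_⊎_; inj₁; inj₂)
open import Data.Unit using (⊤; tt)
open import Data.Product using (_×_; Σ; ∃; _,_)
open import Function using (_on_; _∘_)
open import Induction.WellFounded using (Acc; acc)
open import Relation.Binary.Construct.On as On using ()
open import Relation.Binary.PropositionalEquality
  using (_≡_; refl; sym; trans; cong; subst; module ≡-Reasoning)
open import Relation.Nullary using (¬_; yes; no)

block : ℕ → Word → Word
block k r = U ∷ replicate k D ++ L ∷ r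

UDkL-++ : ∀ k r → UDkL k ++ r ≡ block k r
UDkL-++ k r = cong (U ∷_) (++-assoc (replicate k D) (L ∷ []) r)

isFactorOf-++ˡ : ∀ {v w} p → v IsFactorOf w → v IsFactorOf (p ++ w)
isFactorOf-++ˡ {v} p (q , s , refl) = p ++ q , s , sym (++-assoc p q (v ++ s))

#U-replicate-U : ∀ a w → #U (replicate a U ++ w) ≡ a + #U w
#U-replicate-U zero    w = refl
#U-replicate-U (suc a) w = cong suc (#U-replicate-U a w)

#U-block : ∀ k r → #U (block k r) ≡ suc (#U r)
#U-block zero    r = refl
#U-block (suc k) r = #U-block k r

#DL-block : ∀ k r → #DL (block k r) ≡ suc (k + #DL r)
#DL-block zero    r = refl
#DL-block (suc k) r = cong suc (#DL-block k r)

length-block : ∀ k r → length (block k r) ≡ suc (k + suc (length r))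
length-block zero    r = refl
length-block (suc k) r = cong suc (length-block k r)

isPrefix-++ : ∀ v r → isPrefix v (v ++ r) ≡ true
isPrefix-++ []      r = refl
isPrefix-++ (a ∷ v) r with a ≟S a
... | yes _   = isPrefix-++ v r
... | no a≢a = ⊥-elim (a≢a refl)

isPrefix-sound : ∀ v w → isPrefix v w ≡ true → ∃ λ r → w ≡ v ++ r
isPrefix-sound []      w       _ = w , refl
isPrefix-sound (a ∷ v) (b ∷ w) p with a ≟S b
... | yes refl with isPrefix-sound v w p
...   | r , refl = r , refl

occurrences-block : ∀ k r → occurrences (UDkL k) (block k r) ≡ suc (occurrences (UDkL k) r)
occurrences-block k r
  rewrite subst (λ w → isPrefix (UDkL k) w ≡ true) (UDkL-++ k r) (isPrefix-++ (UDkL k) r)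
  = cong suc (occurrences-DʲL k)
  where
  occurrences-DʲL : ∀ j → occurrences (UDkL k) (replicate j D ++ L ∷ r) ≡ occurrences (UDkL k) r
  occurrences-DʲL zero    = refl
  occurrences-DʲL (suc j) = occurrences-DʲL j

isPrefix-DkL-U : ∀ k w → isPrefix (replicate k D ++ L ∷ []) (U ∷ w) ≡ false
isPrefix-DkL-U zero    w = refl
isPrefix-DkL-U (suc k) w = refl

occurrences-UU : ∀ k w → occurrences (UDkL k) (U ∷ U ∷ w) ≡ occurrences (UDkL k) (U ∷ w)
occurrences-UU k w rewrite isPrefix-DkL-U k w = refl

occurrences-replicate-U : ∀ k a w →
  occurrences (UDkL k) (replicate a U ++ U ∷ w) ≡ occurrences (UDkL k) (U ∷ w)
occurrences-replicate-U k zero          w = refl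
occurrences-replicate-U k (suc zero)    w = occurrences-UU k w
occurrences-replicate-U k (suc (suc a)) w =
  trans (occurrences-UU k (replicate a U ++ U ∷ w)) (occurrences-replicate-U k (suc a) w)

#DL-≤-∷ : ∀ x w → #DL w ≤ #DL (x ∷ w)
#DL-≤-∷ U w = ≤-refl
#DL-≤-∷ D w = n≤1+n _
#DL-≤-∷ L w = n≤1+n _

length-<-block-∷ : ∀ k y r → length r < length (block k (y ∷ r))
length-<-block-∷ k y r rewrite length-block k (y ∷ r) =
  s≤s (≤-trans (n≤1+n _) (≤-trans (n≤1+n _) (m≤n+m _ k)))

isFactorOf-block-∷ : ∀ {v} k y r → v IsFactorOf r → v IsFactorOf block k (y ∷ r)
isFactorOf-block-∷ {v} k y r f =
  subst (v IsFactorOf_) (cong (U ∷_) (++-assoc (replicate k D) (L ∷ y ∷ []) r))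
    (isFactorOf-++ˡ (U ∷ replicate k D ++ L ∷ y ∷ []) f)

blockView : ∀ k w → (∃ λ r → w ≡ block k r) ⊎ (isPrefix (UDkL k) w ≡ false)
blockView k w with isPrefix (UDkL k) w in isPre
... | false = inj₂ refl
... | true with isPrefix-sound (UDkL k) w isPre
...   | r , refl = inj₁ (r , UDkL-++ k r)

occurrences-block-≤ : ∀ k r → occurrences (UDkL k) r * (2 + k) ≤ #DL r →
  occurrences (UDkL k) (block k r) * (2 + k) ≤ suc (#DL (block k r))
occurrences-block-≤ k r h rewrite occurrences-block k r | #DL-block k r = +-monoʳ-≤ (2 + k) h

occurrences-UDkL-≤ : ∀ k w → ¬ (L ∷ U ∷ []) IsFactorOf w →
  occurrences (UDkL k) w * (2 + k) ≤ suc (#DL w)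
occurrences-UDkL-≤ k w = go w (On.wellFounded length <-wellFounded w)
  where
  go : ∀ w → Acc (_<_ on length) w → ¬ (L ∷ U ∷ []) IsFactorOf w →
    occurrences (UDkL k) w * (2 + k) ≤ suc (#DL w)
  go w (acc rs) noLU with blockView k w
  ... | inj₁ ([] , refl) = occurrences-block-≤ k [] z≤n
  ... | inj₁ (U ∷ r , refl) = ⊥-elim (noLU (U ∷ replicate k D , r , refl))
  ... | inj₁ (D ∷ r , refl) = occurrences-block-≤ k (D ∷ r)
          (go r (rs (length-<-block-∷ k D r)) (noLU ∘ isFactorOf-block-∷ k D r))
  ... | inj₁ (L ∷ r , refl) = occurrences-block-≤ k (L ∷ r)
          (go r (rs (length-<-block-∷ k L r)) (noLU ∘ isFactorOf-block-∷ k L r))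
  go []      _        _    | inj₂ _ = z≤n
  go (x ∷ w) (acc rs) noLU | inj₂ notPrefix rewrite notPrefix =
    ≤-trans (go w (rs ≤-refl) (noLU ∘ isFactorOf-++ˡ (x ∷ []))) (s≤s (#DL-≤-∷ x w))

semilength-≥ : ∀ k w → IsSkewDyck w → (k + 2) * occurrences (UDkL k) w ∸ 1 ≤ semilength w
semilength-≥ k w S = begin
  (k + 2) * o ∸ 1  ≡⟨ cong (_∸ 1) (trans (cong (_* o) (+-comm k 2)) (*-comm (2 + k) o)) ⟩
  o * (2 + k) ∸ 1  ≤⟨ ∸-monoˡ-≤ 1 (occurrences-UDkL-≤ k w noLU) ⟩
  #DL w            ≡⟨ sym balanced ⟩
  #U w             ∎
  where
  open IsSkewDyck S
  open ≤-Reasoning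
  o = occurrences (UDkL k) w

-- Walk h w: the path w, started at height h, ends at height 0 and never goes below it.
data Walk : ℕ → Word → Set where
  []   : Walk 0 []
  up   : ∀ {h w} → Walk (suc h) w → Walk h (U ∷ w)
  down : ∀ {h w} → Walk h w → Walk (suc h) (D ∷ w)
  left : ∀ {h w} → Walk h w → Walk (suc h) (L ∷ w)

Walk⇒balanced : ∀ {h w} → Walk h w → #U w + h ≡ #DL w
Walk⇒balanced []       = refl
Walk⇒balanced {h} {U ∷ w} (up W) = trans (sym (+-suc (#U w) h)) (Walk⇒balanced W)
Walk⇒balanced {suc h} {D ∷ w} (down W) = trans (+-suc (#U w) h) (cong suc (Walk⇒balanced W))
Walk⇒balanced {suc h} {L ∷ w} (left W) = trans (+-suc (#U w) h) (cong suc (Walk⇒balanced W))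

Walk⇒prefix-≤ : ∀ {h} p s → Walk h (p ++ s) → #DL p ≤ h + #U p
Walk⇒prefix-≤     []      s W        = z≤n
Walk⇒prefix-≤ {h} (U ∷ p) s (up W)   rewrite +-suc h (#U p) = Walk⇒prefix-≤ p s W
Walk⇒prefix-≤     (D ∷ p) s (down W) = s≤s (Walk⇒prefix-≤ p s W)
Walk⇒prefix-≤     (L ∷ p) s (left W) = s≤s (Walk⇒prefix-≤ p s W)

Walk-replicate-D : ∀ j {h r} → Walk h r → Walk (j + h) (replicate j D ++ r)
Walk-replicate-D zero    W = W
Walk-replicate-D (suc j) W = down (Walk-replicate-D j W)

Walk-replicate-U : ∀ a {h r} → Walk (a + h) r → Walk h (replicate a U ++ r)
Walk-replicate-U zero        W = W
Walk-replicate-U (suc a) {h} {r} W = up (Walk-replicate-U a (subst (λ g → Walk g r) (sym (+-suc a h)) W))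

Walk-block : ∀ k {h r} → Walk h r → Walk (k + h) (block k r)
Walk-block k {h} {r} W =
  up (subst (λ g → Walk g (replicate k D ++ L ∷ r)) (+-suc k h) (Walk-replicate-D k (left W)))

Compatible : Step → Step → Set
Compatible U L = ⊥
Compatible L U = ⊥
Compatible _ _ = ⊤

Linked-factor : ∀ {R : Step → Step → Set} p {x y} s → Linked R (p ++ x ∷ y ∷ s) → R x y
Linked-factor []      s (Rxy ∷ _) = Rxy
Linked-factor (_ ∷ p) s l         = Linked-factor p s (Linked.tail l)

isSkewDyck : ∀ {w} → Walk 0 w → Linked Compatible w → IsSkewDyck w
isSkewDyck {w} W l = record
  { noUL     = λ { (p , s , refl) → Linked-factor p s l }
  ; noLU     = λ { (p , s , refl) → Linked-factor p s l }
  ; balanced = trans (sym (+-identityʳ (#U w))) (Walk⇒balanced W)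
  ; prefixes = λ { p s refl → Walk⇒prefix-≤ p s W }
  }

trail : ℕ → ℕ → Word
trail k zero    = []
trail k (suc m) = D ∷ block k (trail k m)

witness : ℕ → ℕ → Word
witness k m = replicate (k + m * suc k) U ++ block k (trail k m)

Walk-trail : ∀ k m → Walk (m * suc k) (trail k m)
Walk-trail k zero    = []
Walk-trail k (suc m) = down (Walk-block k (Walk-trail k m))

Walk-witness : ∀ k m → Walk 0 (witness k m)
Walk-witness k m = Walk-replicate-U (k + m * suc k)
  (subst (λ g → Walk g (block k (trail k m))) (sym (+-identityʳ _)) (Walk-block k (Walk-trail k m)))

Linked-replicate-D : ∀ j {r} → Linked Compatible (L ∷ r) → Linked Compatible (D ∷ replicate j D ++ L ∷ r)
Linked-replicate-D zero    l = tt ∷ l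
Linked-replicate-D (suc j) l = tt ∷ Linked-replicate-D j l

Linked-replicate-U : ∀ a {r} → Linked Compatible (U ∷ r) → Linked Compatible (U ∷ replicate a U ++ r)
Linked-replicate-U zero    l = l
Linked-replicate-U (suc a) l = tt ∷ Linked-replicate-U a l

-- Needs k ≥ 1: for k = 0 the block is the forbidden factor U L.
Linked-block : ∀ j {x r} → Compatible x U → Linked Compatible (L ∷ r) →
  Linked Compatible (x ∷ block (suc j) r)
Linked-block j xU l = xU ∷ tt ∷ Linked-replicate-D j l

Linked-trail : ∀ j m → Linked Compatible (L ∷ trail (suc j) m)
Linked-trail j zero    = [-]
Linked-trail j (suc m) = tt ∷ Linked-block j tt (Linked-trail j m)

witness-isSkewDyck : ∀ j m → IsSkewDyck (witness (suc j) m)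
witness-isSkewDyck j m = isSkewDyck (Walk-witness (suc j) m)
  (Linked.tail (Linked-replicate-U (suc j + m * suc (suc j)) (Linked-block j tt (Linked-trail j m))))

occurrences-trail : ∀ k m → occurrences (UDkL k) (trail k m) ≡ m
occurrences-trail k zero    = refl
occurrences-trail k (suc m) = trans (occurrences-block k (trail k m)) (cong suc (occurrences-trail k m))

occurrences-witness : ∀ k m → occurrences (UDkL k) (witness k m) ≡ suc m
occurrences-witness k m = begin
  occurrences (UDkL k) (witness k m)        ≡⟨ occurrences-replicate-U k (k + m * suc k) _ ⟩
  occurrences (UDkL k) (block k (trail k m)) ≡⟨ occurrences-block k (trail k m) ⟩
  suc (occurrences (UDkL k) (trail k m))     ≡⟨ cong suc (occurrences-trail k m) ⟩
  suc m                                      ∎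
  where open ≡-Reasoning

#U-trail : ∀ k m → #U (trail k m) ≡ m
#U-trail k zero    = refl
#U-trail k (suc m) = trans (#U-block k (trail k m)) (cong suc (#U-trail k m))

semilength-witness : ∀ k m → semilength (witness k m) ≡ (k + 2) * suc m ∸ 1
semilength-witness k m = begin
  #U (witness k m)                  ≡⟨ #U-replicate-U a (block k (trail k m)) ⟩
  a + #U (block k (trail k m))      ≡⟨ cong (a +_) (#U-block k (trail k m)) ⟩
  a + suc (#U (trail k m))          ≡⟨ cong (λ u → a + suc u) (#U-trail k m) ⟩
  a + suc m                         ≡⟨ cong (_∸ 1) (size k m) ⟩
  (k + 2) * suc m ∸ 1               ∎
  where
  open ≡-Reasoning
  a = k + m * suc k
  size : ∀ k m → suc (k + m * suc k + suc m) ≡ (k + 2) * suc m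
  size = solve-∀

proposition3p1 : (k n : ℕ) → k ≥ 1 → n ≥ 1 →
    (Σ Word λ w → IsSkewDyck w × occurrences (UDkL k) w ≡ n
       × semilength w ≡ (k + 2) * n ∸ 1)
    × ((w : Word) → IsSkewDyck w → occurrences (UDkL k) w ≡ n
       → (k + 2) * n ∸ 1 ≤ semilength w)
proposition3p1 (suc j) (suc m) _ _ =
  (witness k m , witness-isSkewDyck j m , occurrences-witness k m , semilength-witness k m) ,
  λ w S occ≡n → subst (λ n → (k + 2) * n ∸ 1 ≤ semilength w) occ≡n (semilength-≥ k w S)
  where k = suc j
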